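{- Let $\mathbf D\subseteq\mathbf T$ be a maximal (by inclusion) set of pairwise compatible tilings. Then $\mathbf D$ is closed under $\cap$ and $\cup$, and $(\mathbf D,\cap,\cup)$ is a distributive sublattice of the poset $(\mathbf T,\subseteq)$.
   Context: Fix an integer $n\ge 2$, $[n]=\{1,\dots,n\}$, and let $\Lambda$ be the set of triples $ijk$ with $i<j<k$ in $[n]$. For a quadruple $i<j<k<l$, its stick is the ordered sequence $(ijk,ijl,ikl,jkl)$. A subset of $\Lambda$ is a pseudo-tiling; it is a tiling if for every quadruple $i<j<k<l$ its intersection with the stick, written as a 0/1 string along the stick order, is one of $0000,1000,1100,1110,1111,0111,0011,0001$ (these are the inversion sets of rhombus tilings of the zonogon $Z(n;2)$). $\mathbf T$ denotes the set of tilings, partially ordered by inclusion. Two tilings $T,T'$ are compatible if both $T\cap T'$ and $T\cup T'$ are tilings; a set of pairwise compatible tilings is a clique. -}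

module Defs where

open import Data.Nat using (ℕ)
open import Data.Fin using (Fin; _<_)
open import Data.Bool using (Bool; true; false; _∧_; _∨_)
open import Data.Product using (Σ; _,_; proj₁; _×_)
open import Relation.Binary.PropositionalEquality using (_≡_)
open import Algebra.Lattice.Structures using (IsDistributiveLattice)

record Triple (n : ℕ) : Set where
  constructor triple
  field
    i j k : Fin n
    i<j : i < j
    j<k : j < k

-- a pseudo-tiling = a subset of Λ, given by its characteristic function
PTiling : ℕ → Set
PTiling n = Triple n → Bool

data Allowed : Bool → Bool → Bool → Bool → Set where
  s0000 : Allowed false false false false
  s1000 : Allowed true  false false false
  s1100 : Allowed true  true  false false
  s1110 : Allowed true  true  true  false
  s1111 : Allowed true  true  true  true
  s0111 : Allowed false true  true  true
  s0011 : Allowed false false true  true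
  s0001 : Allowed false false false true

IsTiling : {n : ℕ} → PTiling n → Set
IsTiling {n} T =
  (i j k l : Fin n) (i<j : i < j) (j<k : j < k) (k<l : k < l) →
  Allowed (T (triple i j k i<j j<k))
          (T (triple i j l i<j (Data.Fin.Properties.<-trans j<k k<l)))
          (T (triple i k l (Data.Fin.Properties.<-trans i<j j<k) k<l))
          (T (triple j k l j<k k<l))
  where import Data.Fin.Properties

_∩_ : {n : ℕ} → PTiling n → PTiling n → PTiling n
(T ∩ T') t = T t ∧ T' t

_∪_ : {n : ℕ} → PTiling n → PTiling n → PTiling n
(T ∪ T') t = T t ∨ T' t

_⊆_ : {n : ℕ} → PTiling n → PTiling n → Set
T ⊆ T' = ∀ t → T t ≡ true → T' t ≡ true

_≐_ : {n : ℕ} → PTiling n → PTiling n → Set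
T ≐ T' = ∀ t → T t ≡ T' t

Compatible : {n : ℕ} → PTiling n → PTiling n → Set
Compatible T T' = IsTiling (T ∩ T') × IsTiling (T ∪ T')

IsClique : {n : ℕ} → (PTiling n → Set) → Set
IsClique {n} D =
  ((T : PTiling n) → D T → IsTiling T) ×
  ((T T' : PTiling n) → D T → D T' → Compatible T T')

IsMaximalClique : {n : ℕ} → (PTiling n → Set) → Set₁
IsMaximalClique {n} D =
  IsClique D ×
  ((D' : PTiling n → Set) → IsClique D' →
     ((T : PTiling n) → D T → D' T) → (T : PTiling n) → D' T → D T)

ClosedUnder : {n : ℕ} → (PTiling n → Set) → (PTiling n → PTiling n → PTiling n) → Set
ClosedUnder {n} D _op_ = (T T' : PTiling n) → D T → D T' → D (T op T')

Elem : {n : ℕ} → (PTiling n → Set) → Set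
Elem {n} D = Σ (PTiling n) D

_≈[_]_ : {n : ℕ} {D : PTiling n → Set} → Elem D → (PTiling n → Set) → Elem D → Set
x ≈[ D ] y = proj₁ x ≐ proj₁ y

∩D : {n : ℕ} {D : PTiling n → Set} → ClosedUnder D _∩_ → Elem D → Elem D → Elem D
∩D c (T , p) (T' , p') = (T ∩ T') , c T T' p p'

∪D : {n : ℕ} {D : PTiling n → Set} → ClosedUnder D _∪_ → Elem D → Elem D → Elem D
∪D c (T , p) (T' , p') = (T ∪ T') , c T T' p p'

-- (D, ∩, ∪) is a distributive lattice (join = ∪, meet = ∩) whose lattice order
-- (x ≤ y iff x ∩ y ≈ x) is inclusion ⊆
IsDistributiveSublattice : {n : ℕ} (D : PTiling n → Set) →
  ClosedUnder D _∩_ → ClosedUnder D _∪_ → Set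
IsDistributiveSublattice D c∩ c∪ =
  IsDistributiveLattice (λ x y → x ≈[ D ] y) (∪D c∪) (∩D c∩) ×
  ((x y : Elem D) → (proj₁ x ⊆ proj₁ y) → ((∩D c∩ x y) ≈[ D ] x)) ×
  ((x y : Elem D) → ((∩D c∩ x y) ≈[ D ] x) → (proj₁ x ⊆ proj₁ y))

-- Whether a pseudo-tiling is a tiling is decided stick by stick, and ∩, ∪ act
-- on sticks pointwise. A finite check on the 8 admissible strings shows that if
-- three tilings T, U, S are pairwise compatible, then T ∩ U and T ∪ U are both
-- compatible with S. Hence T ∩ U and T ∪ U are compatible with every member of
-- a clique containing T and U; if the clique is maximal they must belong to it.
-- The lattice laws then hold pointwise, being those of the Booleans.
module Submission where

open import Defs
open import Data.Nat using (ℕ; _≤_)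
open import Data.Product using (Σ; _×_; proj₁; proj₂; _,_)
open import Data.Sum using (_⊎_; inj₁; inj₂)
open import Data.Unit using (tt)
open import Data.Bool using (Bool; true; false; T; _∧_; _∨_)
import Data.Bool.Properties as Bool
open import Data.Fin using (Fin; _<_)
open import Data.Fin.Properties using (<-trans)
open import Relation.Nullary using (Dec; yes; no)
open import Relation.Nullary.Decidable using (⌊_⌋; toWitness; _×-dec_; _→-dec_)
open import Relation.Binary.PropositionalEquality
open import Function.Bundles using (Equivalence)
open import Algebra.Lattice.Structures using (IsDistributiveLattice)

Stick : Set
Stick = Bool × Bool × Bool × Bool

_∧ˢ_ : Stick → Stick → Stick
(a , b , c , d) ∧ˢ (a′ , b′ , c′ , d′) = a ∧ a′ , b ∧ b′ , c ∧ c′ , d ∧ d′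

_∨ˢ_ : Stick → Stick → Stick
(a , b , c , d) ∨ˢ (a′ , b′ , c′ , d′) = a ∨ a′ , b ∨ b′ , c ∨ c′ , d ∨ d′

AllowedStick : Stick → Set
AllowedStick (a , b , c , d) = Allowed a b c d

CompatibleSticks : Stick → Stick → Set
CompatibleSticks x y = AllowedStick (x ∧ˢ y) × AllowedStick (x ∨ˢ y)

allowed? : ∀ a b c d → Dec (Allowed a b c d)
allowed? false false false false = yes s0000
allowed? true  false false false = yes s1000
allowed? true  true  false false = yes s1100
allowed? true  true  true  false = yes s1110
allowed? true  true  true  true  = yes s1111
allowed? false true  true  true  = yes s0111
allowed? false false true  true  = yes s0011
allowed? false false false true  = yes s0001
allowed? false false true  false = no λ ()
allowed? false true  false false = no λ ()
allowed? false true  false true  = no λ ()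
allowed? false true  true  false = no λ ()
allowed? true  false false true  = no λ ()
allowed? true  false true  false = no λ ()
allowed? true  false true  true  = no λ ()
allowed? true  true  false true  = no λ ()

allowedStick? : ∀ x → Dec (AllowedStick x)
allowedStick? (a , b , c , d) = allowed? a b c d

compatibleSticks? : ∀ x y → Dec (CompatibleSticks x y)
compatibleSticks? x y = allowedStick? (x ∧ˢ y) ×-dec allowedStick? (x ∨ˢ y)

every : (Bool → Bool) → Bool
every f = f false ∧ f true

every-sound : ∀ f → T (every f) → ∀ b → T (f b)
every-sound f holds false = proj₁ (Equivalence.to Bool.T-∧ holds)
every-sound f holds true  = proj₂ (Equivalence.to Bool.T-∧ holds)

everyStick : (Stick → Bool) → Bool
everyStick f = every λ a → every λ b → every λ c → every λ d → f (a , b , c , d)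

everyStick-sound : ∀ f → T (everyStick f) → ∀ x → T (f x)
everyStick-sound f holds (a , b , c , d) =
  every-sound (λ d → f (a , b , c , d))
    (every-sound (λ c → every λ d → f (a , b , c , d))
      (every-sound (λ b → every λ c → every λ d → f (a , b , c , d))
        (every-sound (λ a → every λ b → every λ c → every λ d → f (a , b , c , d))
          holds a) b) c) d

PairwiseCompatibleSticks : Stick → Stick → Stick → Set
PairwiseCompatibleSticks x y z =
  AllowedStick x × AllowedStick y × AllowedStick z ×
  CompatibleSticks x y × CompatibleSticks x z × CompatibleSticks y z

MeetJoinCompatible : Stick → Stick → Stick → Set
MeetJoinCompatible x y z = CompatibleSticks (x ∧ˢ y) z × CompatibleSticks (x ∨ˢ y) z

meetJoinCompatible? : ∀ x y z →
  Dec (PairwiseCompatibleSticks x y z → MeetJoinCompatible x y z)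
meetJoinCompatible? x y z =
  (allowedStick? x ×-dec allowedStick? y ×-dec allowedStick? z ×-dec
   compatibleSticks? x y ×-dec compatibleSticks? x z ×-dec compatibleSticks? y z)
  →-dec (compatibleSticks? (x ∧ˢ y) z ×-dec compatibleSticks? (x ∨ˢ y) z)

meetJoinCompatibleSticks : ∀ x y z →
  PairwiseCompatibleSticks x y z → MeetJoinCompatible x y z
meetJoinCompatibleSticks x y z = toWitness (checked z)
  where
  check : Stick → Stick → Stick → Bool
  check x y z = ⌊ meetJoinCompatible? x y z ⌋

  checked : ∀ z → T (check x y z)
  checked = everyStick-sound (check x y)
    (everyStick-sound (λ y → everyStick (check x y))
      (everyStick-sound (λ x → everyStick λ y → everyStick (check x y)) tt x) y)

module _ {n : ℕ} where

  stickOf : PTiling n → (i j k l : Fin n) → i < j → j < k → k < l → Stick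
  stickOf T i j k l i<j j<k k<l =
    T (triple i j k i<j j<k) , T (triple i j l i<j (<-trans j<k k<l)) ,
    T (triple i k l (<-trans i<j j<k) k<l) , T (triple j k l j<k k<l)

  isTiling-resp-≐ : {T U : PTiling n} → T ≐ U → IsTiling T → IsTiling U
  isTiling-resp-≐ T≐U tiling i j k l i<j j<k k<l
    rewrite sym (T≐U (triple i j k i<j j<k))
          | sym (T≐U (triple i j l i<j (<-trans j<k k<l)))
          | sym (T≐U (triple i k l (<-trans i<j j<k) k<l))
          | sym (T≐U (triple j k l j<k k<l))
          = tiling i j k l i<j j<k k<l

  compatible-sym : {T U : PTiling n} → Compatible T U → Compatible U T
  compatible-sym {T} {U} (meet , join) =
    isTiling-resp-≐ (λ t → Bool.∧-comm (T t) (U t)) meet ,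
    isTiling-resp-≐ (λ t → Bool.∨-comm (T t) (U t)) join

  compatible-refl : {T : PTiling n} → IsTiling T → Compatible T T
  compatible-refl {T} tiling =
    isTiling-resp-≐ (λ t → sym (Bool.∧-idem (T t))) tiling ,
    isTiling-resp-≐ (λ t → sym (Bool.∨-idem (T t))) tiling

  module _ {T U S : PTiling n}
           (tilingT : IsTiling T) (tilingU : IsTiling U) (tilingS : IsTiling S)
           (compatibleTU : Compatible T U) (compatibleTS : Compatible T S)
           (compatibleUS : Compatible U S) where

    private
      atStick : ∀ i j k l (i<j : i < j) (j<k : j < k) (k<l : k < l) →
        MeetJoinCompatible (stickOf T i j k l i<j j<k k<l)
                           (stickOf U i j k l i<j j<k k<l)
                           (stickOf S i j k l i<j j<k k<l)
      atStick i j k l i<j j<k k<l = meetJoinCompatibleSticks _ _ _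
        ( tilingT i j k l i<j j<k k<l , tilingU i j k l i<j j<k k<l
        , tilingS i j k l i<j j<k k<l
        , atQuadruple {T} {U} compatibleTU , atQuadruple {T} {S} compatibleTS
        , atQuadruple {U} {S} compatibleUS)
        where
        atQuadruple : ∀ {V W} → Compatible V W →
          CompatibleSticks (stickOf V i j k l i<j j<k k<l) (stickOf W i j k l i<j j<k k<l)
        atQuadruple (meet , join) = meet i j k l i<j j<k k<l , join i j k l i<j j<k k<l

    ∩-compatible : Compatible (T ∩ U) S
    ∩-compatible =
      (λ i j k l i<j j<k k<l → proj₁ (proj₁ (atStick i j k l i<j j<k k<l))) ,
      (λ i j k l i<j j<k k<l → proj₂ (proj₁ (atStick i j k l i<j j<k k<l)))

    ∪-compatible : Compatible (T ∪ U) S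
    ∪-compatible =
      (λ i j k l i<j j<k k<l → proj₁ (proj₂ (atStick i j k l i<j j<k k<l))) ,
      (λ i j k l i<j j<k k<l → proj₂ (proj₂ (atStick i j k l i<j j<k k<l)))

  maximalClique-contains : {D : PTiling n → Set} → IsMaximalClique D →
    {X : PTiling n} → IsTiling X → (∀ S → D S → Compatible X S) → D X
  maximalClique-contains {D} ((tiling , compatible) , maximal) {X} tilingX compatibleX =
    maximal D∪X (tiling′ , compatible′) (λ _ → inj₁) X (inj₂ refl)
    where
    D∪X : PTiling n → Set
    D∪X Y = D Y ⊎ Y ≡ X

    tiling′ : ∀ T → D∪X T → IsTiling T
    tiling′ T (inj₁ T∈D)  = tiling T T∈D
    tiling′ T (inj₂ refl) = tilingX

    compatible′ : ∀ T U → D∪X T → D∪X U → Compatible T U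
    compatible′ T U (inj₁ T∈D)  (inj₁ U∈D)  = compatible T U T∈D U∈D
    compatible′ T U (inj₁ T∈D)  (inj₂ refl) = compatible-sym {X} {T} (compatibleX T T∈D)
    compatible′ T U (inj₂ refl) (inj₁ U∈D)  = compatibleX U U∈D
    compatible′ T U (inj₂ refl) (inj₂ refl) = compatible-refl tilingX

  module _ {D : PTiling n → Set} (maximalD : IsMaximalClique D) where

    private
      tiling = proj₁ (proj₁ maximalD)
      compatible = proj₂ (proj₁ maximalD)

    maximalClique-closed-∩ : ClosedUnder D _∩_
    maximalClique-closed-∩ T U T∈D U∈D =
      maximalClique-contains maximalD (proj₁ (compatible T U T∈D U∈D)) λ S S∈D →
        ∩-compatible (tiling T T∈D) (tiling U U∈D) (tiling S S∈D)
          (compatible T U T∈D U∈D) (compatible T S T∈D S∈D) (compatible U S U∈D S∈D)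

    maximalClique-closed-∪ : ClosedUnder D _∪_
    maximalClique-closed-∪ T U T∈D U∈D =
      maximalClique-contains maximalD (proj₂ (compatible T U T∈D U∈D)) λ S S∈D →
        ∪-compatible (tiling T T∈D) (tiling U U∈D) (tiling S S∈D)
          (compatible T U T∈D U∈D) (compatible T S T∈D S∈D) (compatible U S U∈D S∈D)

  ⊆⇒∩≐ : {T U : PTiling n} → T ⊆ U → (T ∩ U) ≐ T
  ⊆⇒∩≐ {T} T⊆U t with T t in Tt
  ... | false = refl
  ... | true  = T⊆U t Tt

  ∩≐⇒⊆ : {T U : PTiling n} → (T ∩ U) ≐ T → T ⊆ U
  ∩≐⇒⊆ {T} {U} T∩U≐T t Tt = begin
    U t          ≡⟨⟩
    true ∧ U t   ≡⟨ cong (_∧ U t) (sym Tt) ⟩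
    T t ∧ U t    ≡⟨ T∩U≐T t ⟩
    T t          ≡⟨ Tt ⟩
    true         ∎
    where open ≡-Reasoning

  module _ {D : PTiling n → Set} (c∩ : ClosedUnder D _∩_) (c∪ : ClosedUnder D _∪_) where

    pointwise-isDistributiveLattice :
      IsDistributiveLattice (λ x y → x ≈[ D ] y) (∪D c∪) (∩D c∩)
    pointwise-isDistributiveLattice = record
      { isLattice = record
        { isEquivalence = record
          { refl  = λ _ → refl
          ; sym   = λ x≐y t → sym (x≐y t)
          ; trans = λ x≐y y≐z t → trans (x≐y t) (y≐z t)
          }
        ; ∨-comm     = λ x y t → Bool.∨-comm (proj₁ x t) (proj₁ y t)
        ; ∨-assoc    = λ x y z t → Bool.∨-assoc (proj₁ x t) (proj₁ y t) (proj₁ z t)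
        ; ∨-cong     = λ x≐y u≐v t → cong₂ _∨_ (x≐y t) (u≐v t)
        ; ∧-comm     = λ x y t → Bool.∧-comm (proj₁ x t) (proj₁ y t)
        ; ∧-assoc    = λ x y z t → Bool.∧-assoc (proj₁ x t) (proj₁ y t) (proj₁ z t)
        ; ∧-cong     = λ x≐y u≐v t → cong₂ _∧_ (x≐y t) (u≐v t)
        ; absorptive = (λ x y t → Bool.∨-abs-∧ (proj₁ x t) (proj₁ y t))
                     , (λ x y t → Bool.∧-abs-∨ (proj₁ x t) (proj₁ y t))
        }
      ; ∨-distrib-∧ = (λ x y z t → Bool.∨-distribˡ-∧ (proj₁ x t) (proj₁ y t) (proj₁ z t))
                    , (λ x y z t → Bool.∨-distribʳ-∧ (proj₁ x t) (proj₁ y t) (proj₁ z t))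
      ; ∧-distrib-∨ = (λ x y z t → Bool.∧-distribˡ-∨ (proj₁ x t) (proj₁ y t) (proj₁ z t))
                    , (λ x y z t → Bool.∧-distribʳ-∨ (proj₁ x t) (proj₁ y t) (proj₁ z t))
      }

mainTheorem6 : (n : ℕ) → 2 ≤ n → (D : PTiling n → Set) → IsMaximalClique D →
    Σ (ClosedUnder D _∩_ × ClosedUnder D _∪_)
      (λ c → IsDistributiveSublattice D (Data.Product.proj₁ c) (Data.Product.proj₂ c))
mainTheorem6 n _ D maximalD =
  (c∩ , c∪) ,
  pointwise-isDistributiveLattice c∩ c∪ ,
  (λ x y → ⊆⇒∩≐ {T = proj₁ x} {U = proj₁ y}) ,
  (λ x y → ∩≐⇒⊆ {T = proj₁ x} {U = proj₁ y})
  where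
  c∩ = maximalClique-closed-∩ maximalD
  c∪ = maximalClique-closed-∪ maximalD
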